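{- For all integers $c,g\ge1$, every graph $G^c(g)$ (constructed as in the context, with any admissible choices) has chromatic number at least $c+1$.
   Context: For $g\ge2$, a $g$-cycle in a hypergraph is a sequence $(v_1,E_1,\dots,v_g,E_g)$ of distinct vertices $v_i$ and distinct edges $E_i$ with $v_i,v_{i+1}\in E_i$ for $i<g$ and $v_g,v_1\in E_g$; the girth is the least length of a cycle (infinite if none). Fix $g\ge1$. Vertex-ordered graphs $G^c(g)$ are defined recursively in $c$. $G^1(g)$ is $K_2$ (two vertices joined by an edge) with a linear order on its vertices. For $c>1$: take some $G^{c-1}(g)$ with $n$ vertices, and some $n$-uniform hypergraph $H=(V_H,\mathcal{E}_H)$ of girth at least $g$ and chromatic number at least $c+1$, with a fixed linear order on $V_H$. The vertex set of $G^c(g)$ consists of $V_H$ together with, for each $S\in\mathcal{E}_H$, a set $T(S)$ of new vertices containing one vertex $v'$ for each $v\in S$, ordered as in $V_H$. Edges: $vv'$ for each $S\in\mathcal{E}_H$ and $v\in S$; and, for each $S\in\mathcal{E}_H$, the edges of a copy of $G^{c-1}(g)$ placed on $T(S)$ via the order-preserving bijection. There are no edges inside $V_H$. $G^c(g)$ is given an arbitrary linear order of its vertices. -}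

module Defs where

open import Data.Nat using (ℕ; zero; suc; _≤_; _<_)
open import Data.Fin using (Fin; zero; suc) renaming (_<_ to _<ᶠ_)
open import Data.Product using (Σ; ∃; ∃-syntax; _×_; _,_)
open import Data.Sum using (_⊎_; inj₁; inj₂)
open import Data.Empty using (⊥)
open import Relation.Nullary using (¬_)
open import Relation.Binary.PropositionalEquality using (_≡_; _≢_)
open import Function.Bundles using (_↔_; _⇔_; Inverse)
open import Function.Definitions using (Injective)

-- A vertex-ordered graph: vertex set Fin N, linear order = the order of Fin N.
record Graph : Set₁ where
  constructor mkGraph
  field
    N   : ℕ
    Adj : Fin N → Fin N → Set
open Graph public

NotGraphColourable : Graph → ℕ → Set
NotGraphColourable G c =
  (col : Fin (N G) → Fin c) → ∃[ x ] ∃[ y ] (Adj G x y × col x ≡ col y)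

-- Each edge is listed as its n vertices in increasing order
-- (so edge e, position j, is the j-th smallest vertex of edge e).
record Hypergraph (n : ℕ) : Set where
  field
    m     : ℕ
    k     : ℕ
    edge  : Fin k → Fin n → Fin m
    edge-increasing : ∀ e (i j : Fin n) → i <ᶠ j → edge e i <ᶠ edge e j
    edge-distinct   : Injective _≡_ _≡_ edge
open Hypergraph public

_∈ₑ_ : ∀ {n} {H : Hypergraph n} → Fin (m H) → Fin (k H) → Set
_∈ₑ_ {H = H} v e = ∃[ j ] (edge H e j ≡ v)

csuc : ∀ {l} → Fin (suc l) → Fin (suc l)
csuc {zero} zero = zero
csuc {suc l} zero = suc zero
csuc {suc l} (suc i) with csuc {l} i
... | zero  = zero
... | suc j = suc (suc j)

Cycle : ∀ {n} (H : Hypergraph n) (l : ℕ) → Set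
Cycle {n} H l =
  Σ (Fin (suc l) → Fin (m H)) λ v →
  Σ (Fin (suc l) → Fin (k H)) λ E →
    Injective _≡_ _≡_ v × Injective _≡_ _≡_ E ×
    (∀ i → _∈ₑ_ {H = H} (v i) (E i) × _∈ₑ_ {H = H} (v (csuc i)) (E i))

-- girth ≥ g: no cycle of length ℓ with 2 ≤ ℓ < g.
GirthAtLeast : ∀ {n} → ℕ → Hypergraph n → Set
GirthAtLeast g H = ∀ l → 1 ≤ l → suc l < g → ¬ Cycle H l

NotHyperColourable : ∀ {n} → Hypergraph n → ℕ → Set
NotHyperColourable H c =
  (col : Fin (m H) → Fin c) → ∃[ e ] (∀ i j → col (edge H e i) ≡ col (edge H e j))

-- vertices of the constructed graph: V_H ⊎ ⋃_S T(S), with T(S_e) = {(e , j)}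
-- where (e , j) is the copy v' of v = edge e j.
CVertex : ∀ {n} → Hypergraph n → Set
CVertex {n} H = Fin (m H) ⊎ (Fin (k H) × Fin n)

CAdj : (G' : Graph) (H : Hypergraph (N G')) → CVertex H → CVertex H → Set
CAdj G' H (inj₁ u) (inj₁ v) = ⊥
CAdj G' H (inj₁ v) (inj₂ (e , j)) = edge H e j ≡ v
CAdj G' H (inj₂ (e , j)) (inj₁ v) = edge H e j ≡ v
CAdj G' H (inj₂ (e , i)) (inj₂ (e' , j)) = e ≡ e' × Adj G' i j

-- IsG g c G : G is (a vertex-ordered graph isomorphic, under an arbitrary
-- vertex order, to) some admissible G^c(g).
data IsG (g : ℕ) : ℕ → Graph → Set₁ where
  base : (A : Fin 2 → Fin 2 → Set) → (∀ x y → A x y ⇔ (x ≢ y)) →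
         IsG g 1 (mkGraph 2 A)
  step : ∀ {c} (G' : Graph) → IsG g c G' →
         (H : Hypergraph (N G')) → GirthAtLeast g H →
         NotHyperColourable H (suc c) →
         (G : Graph) (σ : Fin (N G) ↔ CVertex H) →
         (∀ x y → Adj G x y ⇔ CAdj G' H (Inverse.to σ x) (Inverse.to σ y)) →
         IsG g (suc c) G

-- Colour G^c(g) with c colours.  Restricted to V_H this is a
-- c-colouring of H, so some edge S is monochromatic, say in colour a.  If some
-- copy v' ∈ T(S) also has colour a, the edge vv' is monochromatic.  Otherwise the
-- copy of G^{c-1}(g) on T(S) is coloured with the c-1 colours other than a, and
-- the induction hypothesis yields a monochromatic edge inside T(S).
module Submission where

open import Defs
open import Data.Nat using (ℕ; _≤_; suc)
open import Data.Fin using (Fin; zero; suc; punchOut)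
open import Data.Fin.Properties using (any?; punchOut-injective) renaming (_≟_ to _≟ᶠ_)
open import Data.Sum using (inj₁; inj₂)
open import Data.Product using (∃-syntax; _×_; _,_)
open import Function using (_∘_)
open import Function.Bundles using (_↔_; _⇔_; Inverse; Equivalence)
open import Relation.Nullary using (yes; no)
open import Relation.Binary.PropositionalEquality

NoProperColouring : {V : Set} → (V → V → Set) → ℕ → Set
NoProperColouring {V} R c =
  (col : V → Fin c) → ∃[ x ] ∃[ y ] (R x y × col x ≡ col y)

noProperColouring-↔ : ∀ {V W : Set} {R : V → V → Set} {S : W → W → Set} {c} →
                      (σ : V ↔ W) →
                      (∀ x y → R x y ⇔ S (Inverse.to σ x) (Inverse.to σ y)) →
                      NoProperColouring S c → NoProperColouring R c
noProperColouring-↔ {S = S} σ R⇔S noColS col with noColS (col ∘ Inverse.from σ)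
... | u , v , Suv , same =
  from u , from v , Equivalence.from (R⇔S (from u) (from v)) Sfromuv , same
  where
  open Inverse σ
  Sfromuv : S (to (from u)) (to (from v))
  Sfromuv = subst₂ S (sym (strictlyInverseˡ u)) (sym (strictlyInverseˡ v)) Suv

noProperColouring-K₂ : (A : Fin 2 → Fin 2 → Set) → (∀ x y → A x y ⇔ (x ≢ y)) →
                       NoProperColouring A 1
noProperColouring-K₂ A A⇔≢ col =
  zero , suc zero , Equivalence.from (A⇔≢ zero (suc zero)) (λ ()) , Fin1-irrelevant _ _
  where
  Fin1-irrelevant : (a b : Fin 1) → a ≡ b
  Fin1-irrelevant zero zero = refl

-- p is constant, so col misses the colour p x and punching it out leaves c colours.
noProperColouring-avoiding : ∀ {V : Set} {R : V → V → Set} {c} →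
                             NoProperColouring R c →
                             (col p : V → Fin (suc c)) →
                             (∀ x y → p x ≡ p y) → (∀ x → p x ≢ col x) →
                             ∃[ x ] ∃[ y ] (R x y × col x ≡ col y)
noProperColouring-avoiding noCol col p p-const p≢col
  with noCol (λ x → punchOut (p≢col x))
... | x , y , Rxy , same =
  x , y , Rxy , punchOut-injective′ (p≢col x) (p≢col y) (p-const x y) same
  where
  punchOut-injective′ : ∀ {c} {i i′ j k : Fin (suc c)} (i≢j : i ≢ j) (i′≢k : i′ ≢ k) →
                        i ≡ i′ → punchOut i≢j ≡ punchOut i′≢k → j ≡ k
  punchOut-injective′ i≢j i′≢k refl = punchOut-injective i≢j i′≢k

noProperColouring-construction : ∀ {c} (G′ : Graph) (H : Hypergraph (N G′)) →
                                 NotGraphColourable G′ c →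
                                 NotHyperColourable H (suc c) →
                                 NoProperColouring (CAdj G′ H) (suc c)
noProperColouring-construction G′ H noColG′ noColH col
  with noColH (col ∘ inj₁)
... | e , mono with any? (λ i → col (inj₂ (e , i)) ≟ᶠ col (inj₁ (edge H e i)))
... | yes (i , same) = inj₁ (edge H e i) , inj₂ (e , i) , refl , sym same
... | no noneSame with noProperColouring-avoiding noColG′
        (λ i → col (inj₂ (e , i))) (λ i → col (inj₁ (edge H e i))) mono
        (λ i same → noneSame (i , sym same))
...   | i , j , Aij , same = inj₂ (e , i) , inj₂ (e , j) , (refl , Aij) , same

IsG⇒NotGraphColourable : ∀ {g c G} → IsG g c G → NotGraphColourable G c
IsG⇒NotGraphColourable (base A A⇔≢) = noProperColouring-K₂ A A⇔≢
IsG⇒NotGraphColourable (step G′ isG′ H _ noColH G σ Adj⇔CAdj) =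
  noProperColouring-↔ σ Adj⇔CAdj
    (noProperColouring-construction G′ H (IsG⇒NotGraphColourable isG′) noColH)

lemma4 : ∀ (c g : ℕ) → 1 ≤ c → 1 ≤ g → (G : Graph) → IsG g c G →
         NotGraphColourable G c
lemma4 _ _ _ _ _ = IsG⇒NotGraphColourable
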